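{- Let $T$ be a computably locally compact tree in which only the root is infinitely branching (every nonempty string in $T$ has only finitely many immediate successors in $T$). Let $S$ be a computable subtree of $T$ (possibly with leaves), and suppose there is a uniformly computable sequence $(f_i)_{i\in\mathbb N}$ of elements of $[S]$ that is dense in $[S]$. Then the tree $\widetilde S=\{\sigma:[\sigma]_S\neq\emptyset\}$ is decidable.
   Context: $\mathbb N^*$ is the set of finite strings of naturals; a tree is a nonempty prefix-closed subset of $\mathbb N^*$; $[S]$ is the set of infinite paths of $S$ with the topology from Baire space, and $[\sigma]_S=\{f\in[S]:\sigma\prec f\}$. A computable tree $T$ without leaves is computably locally compact if $[T]$ is locally compact, $\{\sigma\in T:[\sigma]_T\text{ compact}\}$ is decidable, and there is a computable $H$ such that whenever $[\sigma]_T$ is compact and $\rho\in T$ extends $\sigma$, $\rho(i)\le H(\sigma,i)$ for all $i<|\rho|$. A sequence $(f_i)$ of functions $\mathbb N\to\mathbb N$ is uniformly computable if $(i,n)\mapsto f_i(n)$ is computable. -}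

module Defs where

open import Data.Nat using (ℕ; zero; suc; _≤_; _<_)
open import Data.Bool using (Bool; true)
open import Data.List using (List; []; _∷_; _++_; [_]; length; lookup)
open import Data.List.Relation.Unary.All using (All)
open import Data.List.Relation.Unary.Any using (Any)
open import Data.Fin using (fromℕ<)
open import Data.Product using (Σ; ∃; _×_; _,_)
open import Relation.Binary.PropositionalEquality using (_≡_; _≢_)
open import Relation.Nullary using (¬_)
open import Level using (Level) renaming (suc to lsuc; zero to lzero)

Str : Set
Str = List ℕ

Path : Set
Path = ℕ → ℕ

-- A computable set of strings is represented by its (Agda-computable)
-- characteristic function.
CSet : Set
CSet = Str → Bool

_∈ₛ_ : Str → CSet → Set
σ ∈ₛ T = T σ ≡ true

_↾_ : Path → ℕ → Str
f ↾ zero = []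
f ↾ suc n = f zero ∷ ((λ k → f (suc k)) ↾ n)

_≺_ : Str → Path → Set
σ ≺ f = f ↾ length σ ≡ σ

_⪯_ : Str → Str → Set
σ ⪯ ρ = ∃ λ τ → σ ++ τ ≡ ρ

IsTree : CSet → Set
IsTree T = ([] ∈ₛ T) × (∀ σ τ → (σ ++ τ) ∈ₛ T → σ ∈ₛ T)

NoLeaves : CSet → Set
NoLeaves T = ∀ σ → σ ∈ₛ T → ∃ λ k → (σ ++ [ k ]) ∈ₛ T

Paths : CSet → Path → Set
Paths T f = ∀ n → (f ↾ n) ∈ₛ T

Cone : CSet → Str → Path → Set
Cone T σ f = Paths T f × σ ≺ f

-- An open set of Baire space is a union of basic
-- open sets N_τ = {f : τ ≺ f}; an open cover is thus given by a family U of
-- strings whose basic open sets cover K, and a finite subcover by a finite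
-- list of members of U whose basic open sets still cover K.
Compact : (Path → Set) → Set₁
Compact K =
  (U : Str → Set) →
  (∀ f → K f → ∃ λ τ → U τ × τ ≺ f) →
  ∃ λ (L : List Str) → All U L × (∀ f → K f → Any (λ τ → τ ≺ f) L)

LocallyCompact : (Path → Set) → Set₁
LocallyCompact X =
  ∀ f → X f →
  Σ (Path → Set) λ K → Compact K × (∀ g → K g → X g) ×
    (∃ λ n → ∀ g → X g → (f ↾ n) ≺ g → K g)

-- Computably locally compact tree (computability rendered as Agda functions).
record ComputablyLocallyCompact (T : CSet) : Set₁ where
  field
    tree        : IsTree T
    noLeaves    : NoLeaves T
    locCompact  : LocallyCompact (Paths T)
    compactDec  : Str → Bool
    compactDec-spec : ∀ σ → (compactDec σ ≡ true → σ ∈ₛ T × Compact (Cone T σ))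
                          × (σ ∈ₛ T × Compact (Cone T σ) → compactDec σ ≡ true)
    H           : Str → ℕ → ℕ
    H-bound     : ∀ σ ρ → Compact (Cone T σ) → ρ ∈ₛ T → σ ⪯ ρ →
                  ∀ i (p : i < length ρ) → lookup ρ (fromℕ< p) ≤ H σ i

OnlyRootInfinitelyBranching : CSet → Set
OnlyRootInfinitelyBranching T =
  ∀ σ → σ ≢ [] → σ ∈ₛ T → ∃ λ b → ∀ k → (σ ++ [ k ]) ∈ₛ T → k < b

IsSubtree : CSet → CSet → Set
IsSubtree S T = IsTree S × (∀ σ → σ ∈ₛ S → σ ∈ₛ T)

DenseIn : (ℕ → Path) → CSet → Set
DenseIn f S = ∀ σ → (∃ λ g → Cone S σ g) → ∃ λ i → σ ≺ f i

MarkovPrinciple : Set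
MarkovPrinciple = (p : ℕ → Bool) → ¬ ¬ (∃ λ n → p n ≡ true) → ∃ λ n → p n ≡ true

DecidableSet : (Str → Set) → Set
DecidableSet P = Σ (Str → Bool) λ χ → ∀ σ → (χ σ ≡ true → P σ) × (P σ → χ σ ≡ true)

Stilde : CSet → Str → Set
Stilde S σ = ∃ λ g → Cone S σ g

{-# OPTIONS --safe #-}
-- Away from the root every cone [σ]_T is compact: otherwise finite branching yields a
-- path all of whose nodes have noncompact cones, contradicting local compactness at that
-- path. On a compact cone all paths are bounded by H σ, so [σ]_S is empty iff for some n
-- no H σ-bounded extension of σ by n entries lies in S (compactness and Markov's
-- principle); emptiness is thus Σ₁. Nonemptiness is Σ₁ by density of (f i), and
-- Markov's principle decides a proposition whose truth and falsity are both Σ₁.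
module Submission where

open import Defs
open import Data.Nat using (ℕ; zero; suc; _+_; _≤_; _<_; z≤n; s≤s; s≤s⁻¹; _≟_)
open import Data.Nat.Properties
  using (+-identityʳ; ≤-refl; ≤-trans; m≤n+m; m≤m+n; m≤n⇒m≤1+n; m≤n⇒m<n∨m≡n; anyUpTo?)
open import Data.Bool using (Bool; true; false; not)
open import Data.Bool.Properties using (not-injective; ¬-not)
import Data.Bool as Bool
open import Data.List using (List; []; _∷_; _++_; [_]; _∷ʳ_; length; lookup; map)
open import Data.List.Properties using (∷-injective; ++-identityʳ; ++-assoc; ∷ʳ-++; length-++-≤ʳ; ≡-dec)
open import Data.List.Relation.Unary.All using (All; []; _∷_; lookupAny; zip)
import Data.List.Relation.Unary.All.Properties as All
import Data.List.Relation.Unary.Any.Properties as Any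
open import Data.List.Relation.Unary.Any using (Any; here; there)
open import Data.List.Extrema.Nat using (max; xs≤max)
open import Data.Fin using (fromℕ<)
open import Data.Product using (Σ; ∃; _×_; _,_; proj₁; proj₂)
open import Data.Sum using (_⊎_; inj₁; inj₂)
open import Data.Empty using (⊥; ⊥-elim)
open import Function using (_∘_; case_of_)
open import Relation.Binary.PropositionalEquality using (module ≡-Reasoning; _≡_; _≢_; refl; sym; trans; cong; cong₂; subst; subst₂)
open import Relation.Nullary using (¬_; Dec; yes; no; does; ¬?; map′; _⊎-dec_)
open import Relation.Nullary.Decidable using (dec-true; decidable-stable)
open import Relation.Unary using (_⊆_; _≐_; _∪_; Empty)
open import Relation.Unary.Properties using (≐-sym)

private
  variable
    f g : Path
    ρ σ τ : Str
    A B K : Path → Set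
    T S : CSet

length-↾ : ∀ (f : Path) n → length (f ↾ n) ≡ n
length-↾ f zero = refl
length-↾ f (suc n) = cong suc (length-↾ (f ∘ suc) n)

↾-suc : ∀ (f : Path) n → f ↾ suc n ≡ f ↾ n ∷ʳ f n
↾-suc f zero = refl
↾-suc f (suc n) = cong (f zero ∷_) (↾-suc (f ∘ suc) n)

↾-⪯ : ∀ {m n} → m ≤ n → (f ↾ m) ⪯ (f ↾ n)
↾-⪯ {f} {n = n} z≤n = f ↾ n , refl
↾-⪯ {f} (s≤s m≤n) with τ , e ← ↾-⪯ {f ∘ suc} m≤n = τ , cong (f zero ∷_) e

↾-≺ : ∀ (f : Path) n → (f ↾ n) ≺ f
↾-≺ f n = cong (f ↾_) (length-↾ f n)

++-≺ : ∀ σ {τ f} → (σ ++ τ) ≺ f → σ ≺ f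
++-≺ [] _ = refl
++-≺ (x ∷ σ) p with e₀ , e ← ∷-injective p = cong₂ _∷_ e₀ (++-≺ σ e)

⪯-≺ : σ ⪯ ρ → ρ ≺ f → σ ≺ f
⪯-≺ {σ} (τ , refl) = ++-≺ σ

≺-⪯ : τ ≺ g → ρ ≺ g → length τ ≤ length ρ → τ ⪯ ρ
≺-⪯ τ≺g ρ≺g le = subst₂ _⪯_ τ≺g ρ≺g (↾-⪯ le)

≺-∷ʳ : ∀ ρ {g} → ρ ≺ g → (ρ ∷ʳ g (length ρ)) ≺ g
≺-∷ʳ [] _ = refl
≺-∷ʳ (x ∷ ρ) p with e₀ , e ← ∷-injective p = cong₂ _∷_ e₀ (≺-∷ʳ ρ e)

≺-∈ : Paths S g → ρ ≺ g → ρ ∈ₛ S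
≺-∈ {S} {ρ = ρ} gS ρ≺g = subst (_∈ₛ S) ρ≺g (gS (length ρ))

∈-⪯ : IsTree T → σ ⪯ ρ → ρ ∈ₛ T → σ ∈ₛ T
∈-⪯ tree (τ , refl) = proj₂ tree _ τ

lookup-↾ : ∀ (f : Path) n i (p : i < length (f ↾ n)) → lookup (f ↾ n) (fromℕ< p) ≡ f i
lookup-↾ f (suc n) zero p = refl
lookup-↾ f (suc n) (suc i) p = lookup-↾ (f ∘ suc) n i (s≤s⁻¹ p)

∷ʳ≢[] : ∀ (ρ : Str) {k} → (ρ ∷ʳ k) ≢ []
∷ʳ≢[] [] ()
∷ʳ≢[] (_ ∷ _) ()

_≺?_ : ∀ σ g → Dec (σ ≺ g)
σ ≺? g = ≡-dec _≟_ (g ↾ length σ) σ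

Paths-of-cofinal : IsTree T → ∀ c → (∀ n → (g ↾ (c + n)) ∈ₛ T) → Paths T g
Paths-of-cofinal tree c cofinal n = ∈-⪯ tree (↾-⪯ (m≤n+m n c)) (cofinal n)

_++ᵖ_ : Str → Path → Path
([] ++ᵖ h) i = h i
((x ∷ ρ) ++ᵖ h) zero = x
((x ∷ ρ) ++ᵖ h) (suc i) = (ρ ++ᵖ h) i

++ᵖ-↾ : ∀ ρ h n → (ρ ++ᵖ h) ↾ (length ρ + n) ≡ ρ ++ h ↾ n
++ᵖ-↾ [] h n = refl
++ᵖ-↾ (x ∷ ρ) h n = cong (x ∷_) (++ᵖ-↾ ρ h n)

++ᵖ-≺ : ∀ ρ h → ρ ≺ (ρ ++ᵖ h)
++ᵖ-≺ ρ h = begin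
  (ρ ++ᵖ h) ↾ length ρ        ≡⟨ cong ((ρ ++ᵖ h) ↾_) (+-identityʳ (length ρ)) ⟨
  (ρ ++ᵖ h) ↾ (length ρ + 0)  ≡⟨ ++ᵖ-↾ ρ h 0 ⟩
  ρ ++ []                     ≡⟨ ++-identityʳ ρ ⟩
  ρ                           ∎
  where open ≡-Reasoning

module _ {ℓ} (P : Str → Set ℓ) (extend : ∀ ρ → P ρ → ∃ λ k → P (ρ ∷ʳ k)) where

  path-through : P ρ → ∃ λ h → ∀ n → P (ρ ++ h ↾ n)
  path-through {ρ} p = h , λ n → subst P (chain-≡ n) (proj₂ (chain n))
    where
    chain : ℕ → Σ Str P
    chain zero = ρ , p
    chain (suc n) with ρₙ , pₙ ← chain n = ρₙ ∷ʳ proj₁ (extend ρₙ pₙ) , proj₂ (extend ρₙ pₙ)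

    h : Path
    h n = proj₁ (extend (proj₁ (chain n)) (proj₂ (chain n)))

    chain-≡ : ∀ n → proj₁ (chain n) ≡ ρ ++ h ↾ n
    chain-≡ zero = sym (++-identityʳ ρ)
    chain-≡ (suc n) = begin
      proj₁ (chain n) ∷ʳ h n     ≡⟨ cong (_∷ʳ h n) (chain-≡ n) ⟩
      (ρ ++ h ↾ n) ∷ʳ h n        ≡⟨ ++-assoc ρ (h ↾ n) [ h n ] ⟩
      ρ ++ (h ↾ n ∷ʳ h n)        ≡⟨ cong (ρ ++_) (↾-suc h n) ⟨
      ρ ++ h ↾ suc n             ∎
      where open ≡-Reasoning

extend-to-path : IsTree T → NoLeaves T → ρ ∈ₛ T → ∃ λ g → Cone T ρ g
extend-to-path {T} {ρ} tree noLeaves ρ∈T with h , h∈T ← path-through (_∈ₛ T) noLeaves ρ∈T =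
  ρ ++ᵖ h ,
  Paths-of-cofinal tree (length ρ) (λ n → subst (_∈ₛ T) (sym (++ᵖ-↾ ρ h n)) (h∈T n)) ,
  ++ᵖ-≺ ρ h

Compact-resp : A ≐ B → Compact A → Compact B
Compact-resp (A⊆B , B⊆A) cA U cover with L , L⊆U , L-covers ← cA U (λ f a → cover f (A⊆B a)) =
  L , L⊆U , λ f b → L-covers f (B⊆A b)

Compact-empty : Empty K → Compact K
Compact-empty K-empty U cover = [] , [] , λ f k → ⊥-elim (K-empty f k)

Compact-∪ : Compact A → Compact B → Compact (A ∪ B)
Compact-∪ cA cB U cover
  with LA , LA⊆U , LA-covers ← cA U (λ f a → cover f (inj₁ a))
     | LB , LB⊆U , LB-covers ← cB U (λ f b → cover f (inj₂ b)) =
  LA ++ LB , All.++⁺ LA⊆U LB⊆U ,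
  λ { f (inj₁ a) → Any.++⁺ˡ (LA-covers f a) ; f (inj₂ b) → Any.++⁺ʳ LA (LB-covers f b) }

Compact-⋃< : ∀ {A : ℕ → Path → Set} b → (∀ k → k < b → Compact (A k)) →
  Compact (λ g → ∃ λ k → k < b × A k g)
Compact-⋃< zero _ = Compact-empty λ { g (_ , () , _) }
Compact-⋃< {A} (suc b) cA =
  Compact-resp (split , join) (Compact-∪ (Compact-⋃< b λ k k<b → cA k (m≤n⇒m≤1+n k<b)) (cA b ≤-refl))
  where
  split : (λ g → ∃ λ k → k < b × A k g) ∪ A b ⊆ (λ g → ∃ λ k → k < suc b × A k g)
  split (inj₁ (k , k<b , a)) = k , m≤n⇒m≤1+n k<b , a
  split (inj₂ a) = b , ≤-refl , a
  join : (λ g → ∃ λ k → k < suc b × A k g) ⊆ (λ g → ∃ λ k → k < b × A k g) ∪ A b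
  join (k , k<1+b , a) with m≤n⇒m<n∨m≡n (s≤s⁻¹ k<1+b)
  ... | inj₁ k<b = inj₁ (k , k<b , a)
  ... | inj₂ refl = inj₂ a

-- Constructively, "K is closed in A" has to come with a decision at each point of A.
Compact-closed : Compact A → K ⊆ A →
  (∀ {f} → A f → K f ⊎ ∃ λ τ → τ ≺ f × ∀ {g} → τ ≺ g → ¬ K g) → Compact K
Compact-closed {A} {K} cA K⊆A decide U cover = prune (cA U′ cover′)
  where
  U′ : Str → Set
  U′ τ = U τ ⊎ ∀ {g} → τ ≺ g → ¬ K g
  cover′ : ∀ f → A f → ∃ λ τ → U′ τ × τ ≺ f
  cover′ f a with decide a
  ... | inj₁ k with τ , u , τ≺f ← cover f k = τ , inj₁ u , τ≺f
  ... | inj₂ (τ , τ≺f , τ-misses) = τ , inj₂ τ-misses , τ≺f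
  keep : ∀ L → All U′ L → List Str
  keep [] [] = []
  keep (τ ∷ L) (inj₁ _ ∷ ok) = τ ∷ keep L ok
  keep (τ ∷ L) (inj₂ _ ∷ ok) = keep L ok
  keep⊆U : ∀ L ok → All U (keep L ok)
  keep⊆U [] [] = []
  keep⊆U (τ ∷ L) (inj₁ u ∷ ok) = u ∷ keep⊆U L ok
  keep⊆U (τ ∷ L) (inj₂ _ ∷ ok) = keep⊆U L ok
  keep-covers : ∀ L ok {f} → K f → Any (_≺ f) L → Any (_≺ f) (keep L ok)
  keep-covers (τ ∷ L) (inj₁ _ ∷ ok) k (here τ≺f) = here τ≺f
  keep-covers (τ ∷ L) (inj₁ _ ∷ ok) k (there p) = there (keep-covers L ok k p)
  keep-covers (τ ∷ L) (inj₂ τ-misses ∷ ok) k (here τ≺f) = ⊥-elim (τ-misses τ≺f k)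
  keep-covers (τ ∷ L) (inj₂ _ ∷ ok) k (there p) = keep-covers L ok k p
  prune : (∃ λ L → All U′ L × ∀ f → A f → Any (_≺ f) L) →
    ∃ λ L → All U L × ∀ f → K f → Any (_≺ f) L
  prune (L , ok , covers) = keep L ok , keep⊆U L ok , λ f k → keep-covers L ok k (covers f (K⊆A k))

Cone-compact-within : Compact K → K ⊆ Paths T → Cone T ρ ⊆ K → Compact (Cone T ρ)
Cone-compact-within {K} {T} {ρ} cK K⊆T cone⊆K = Compact-closed cK cone⊆K decide
  where
  decide : ∀ {f} → K f → Cone T ρ f ⊎ ∃ λ τ → τ ≺ f × ∀ {g} → τ ≺ g → ¬ Cone T ρ g
  decide {f} k with ρ ≺? f
  ... | yes ρ≺f = inj₁ (K⊆T k , ρ≺f)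
  ... | no ρ⊀f = inj₂ (f ↾ length ρ , ↾-≺ f _ , λ {g} f↾≺g (_ , ρ≺g) → ρ⊀f (begin
      f ↾ length ρ                  ≡⟨ f↾≺g ⟨
      g ↾ length (f ↾ length ρ)     ≡⟨ cong (g ↾_) (length-↾ f _) ⟩
      g ↾ length ρ                  ≡⟨ ρ≺g ⟩
      ρ                             ∎))
    where open ≡-Reasoning

Cone-empty : T ρ ≡ false → Empty (Cone T ρ)
Cone-empty ρ∉T g (gT , ρ≺g) with () ← trans (sym ρ∉T) (≺-∈ gT ρ≺g)

¬Compact⇒∈ : ¬ Compact (Cone T ρ) → ρ ∈ₛ T
¬Compact⇒∈ {T} {ρ} ¬cρ with T ρ in e
... | true = refl
... | false = ⊥-elim (¬cρ (Compact-empty (Cone-empty e)))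

Cone≐⋃children : ∀ {b} → (∀ k → (ρ ∷ʳ k) ∈ₛ T → k < b) →
  Cone T ρ ≐ (λ g → ∃ λ k → k < b × Cone T (ρ ∷ʳ k) g)
Cone≐⋃children {ρ} {T} bounded =
  (λ { {g} (gT , ρ≺g) → g (length ρ) , bounded _ (≺-∈ {T} gT (≺-∷ʳ ρ ρ≺g)) , gT , ≺-∷ʳ ρ ρ≺g }) ,
  λ { (k , _ , gT , ρk≺g) → gT , ++-≺ ρ ρk≺g }

module _ {T : CSet} (clc : ComputablyLocallyCompact T) where
  open ComputablyLocallyCompact clc

  Cone-compact? : ∀ ρ → Dec (Compact (Cone T ρ))
  Cone-compact? ρ with T ρ in ρ∈T | compactDec ρ in dec
  ... | false | _ = yes (Compact-empty (Cone-empty ρ∈T))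
  ... | true | true = yes (proj₂ (proj₁ (compactDec-spec ρ) dec))
  ... | true | false = no λ cρ → case trans (sym (proj₂ (compactDec-spec ρ) (ρ∈T , cρ))) dec of λ ()

  H-bound-path : Compact (Cone T σ) → Cone T σ g → ∀ i → g i ≤ H σ i
  H-bound-path {σ} {g} cσ (gT , σ≺g) i =
    subst (_≤ H σ i) (lookup-↾ g n i i<n) (H-bound σ (g ↾ n) cσ (gT n) σ⪯g↾n i i<n)
    where
    n = suc i + length σ
    i<n : i < length (g ↾ n)
    i<n = subst (i <_) (sym (length-↾ g n)) (s≤s (m≤m+n i (length σ)))
    σ⪯g↾n : σ ⪯ (g ↾ n)
    σ⪯g↾n = subst (_⪯ (g ↾ n)) σ≺g (↾-⪯ (m≤n+m (length σ) (suc i)))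

  module _ (branching : OnlyRootInfinitelyBranching T) where

    -- Away from the root a cone is the finite union of the cones of its children.
    noncompact-child : ∀ ρ → ρ ≢ [] × ¬ Compact (Cone T ρ) →
      ∃ λ k → (ρ ∷ʳ k) ≢ [] × ¬ Compact (Cone T (ρ ∷ʳ k))
    noncompact-child ρ (ρ≢[] , ¬cρ)
      with b , bounded ← branching ρ ρ≢[] (¬Compact⇒∈ {T} ¬cρ)
      with anyUpTo? (λ k → ¬? (Cone-compact? (ρ ∷ʳ k))) b
    ... | yes (k , _ , ¬ck) = k , ∷ʳ≢[] ρ , ¬ck
    ... | no none =
      ⊥-elim (¬cρ (Compact-resp (≐-sym (Cone≐⋃children {T = T} bounded)) (Compact-⋃< b children-compact)))
      where
      children-compact : ∀ k → k < b → Compact (Cone T (ρ ∷ʳ k))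
      children-compact k k<b = decidable-stable (Cone-compact? _) λ ¬ck → none (k , k<b , ¬ck)

    Cone-compact-nonroot : σ ≢ [] → Compact (Cone T σ)
    Cone-compact-nonroot {σ} σ≢[] = decidable-stable (Cone-compact? σ) λ ¬cσ →
      let h , noncompact = path-through (λ ρ → ρ ≢ [] × ¬ Compact (Cone T ρ)) noncompact-child (σ≢[] , ¬cσ)
          g = σ ++ᵖ h
          g↾ = ++ᵖ-↾ σ h
          gT = Paths-of-cofinal {T} tree (length σ) λ n →
                 subst (_∈ₛ T) (sym (g↾ n)) (¬Compact⇒∈ {T} (proj₂ (noncompact n)))
          K , cK , K⊆T , N , nbhd = locCompact g gT
          cone⊆K : Cone T (σ ++ h ↾ N) ⊆ K
          cone⊆K = λ { {f} (fT , ρ≺f) →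
                     nbhd f fT (⪯-≺ (↾-⪯ (m≤n+m N (length σ))) (subst (_≺ f) (sym (g↾ N)) ρ≺f)) }
      in proj₂ (noncompact N) (Cone-compact-within {T = T} cK (λ {f} → K⊆T f) cone⊆K)

module _ (S : CSet) (b : ℕ → ℕ) where

  BoundedExtension : ℕ → Str → Set
  BoundedExtension zero ρ = ρ ∈ₛ S
  BoundedExtension (suc n) ρ = ∃ λ k → k ≤ b (length ρ) × BoundedExtension n (ρ ∷ʳ k)

  boundedExtension? : ∀ n ρ → Dec (BoundedExtension n ρ)
  boundedExtension? zero ρ = S ρ Bool.≟ true
  boundedExtension? (suc n) ρ =
    map′ (λ (k , k<1+b , ext) → k , s≤s⁻¹ k<1+b , ext) (λ (k , k≤b , ext) → k , s≤s k≤b , ext)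
      (anyUpTo? (λ k → boundedExtension? n (ρ ∷ʳ k)) (suc (b (length ρ))))

  path⇒BoundedExtension : Paths S g → (∀ i → g i ≤ b i) → ∀ n → ρ ≺ g → BoundedExtension n ρ
  path⇒BoundedExtension gS _ zero ρ≺g = ≺-∈ {S} gS ρ≺g
  path⇒BoundedExtension {g} {ρ} gS g≤b (suc n) ρ≺g =
    g (length ρ) , g≤b (length ρ) , path⇒BoundedExtension gS g≤b n (≺-∷ʳ ρ ρ≺g)

  BoundedExtension⇒∈ : ∀ n → BoundedExtension n ρ → ∃ λ τ → length τ ≡ n × (ρ ++ τ) ∈ₛ S
  BoundedExtension⇒∈ {ρ} zero ρ∈S = [] , refl , subst (_∈ₛ S) (sym (++-identityʳ ρ)) ρ∈S
  BoundedExtension⇒∈ {ρ} (suc n) (k , _ , ext) with τ , |τ|≡n , ρkτ∈S ← BoundedExtension⇒∈ n ext =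
    k ∷ τ , cong suc |τ|≡n , subst (_∈ₛ S) (∷ʳ-++ ρ k τ) ρkτ∈S

markov-exit : MarkovPrinciple → (p : ℕ → Bool) → ¬ (∀ n → p n ≡ true) → ∃ λ n → p n ≡ false
markov-exit mp p ¬all
  with n , e ← mp (not ∘ p) (λ ¬ex → ¬all λ n → not-injective (¬-not λ e → ¬ex (n , e))) =
  n , not-injective e

record Semidecidable (P : Set) : Set₁ where
  field
    Witness  : ℕ → Set
    witness? : ∀ n → Dec (Witness n)
    sound    : ∀ {n} → Witness n → P
    complete : P → ∃ Witness

refuted-semidecidable : ∀ {P} → ¬ P → Semidecidable P
refuted-semidecidable ¬p = record
  { Witness = λ _ → ⊥ ; witness? = λ _ → no λ () ; sound = λ () ; complete = ⊥-elim ∘ ¬p }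

markov-decide : MarkovPrinciple → ∀ {P} → Semidecidable P → Semidecidable (¬ P) → Dec P
markov-decide mp {P} sP s¬P = decide-at (mp (does ∘ either?) (λ ¬ex → unsearchable (¬ex ∘ witnessed)))
  where
  open Semidecidable
  either? : ∀ n → Dec (Witness sP n ⊎ Witness s¬P n)
  either? n = witness? sP n ⊎-dec witness? s¬P n
  witnessed : ∃ (λ n → Witness sP n ⊎ Witness s¬P n) → ∃ λ n → does (either? n) ≡ true
  witnessed (n , w) = n , dec-true (either? n) w
  unsearchable : ¬ ¬ ∃ λ n → Witness sP n ⊎ Witness s¬P n
  unsearchable none =
    let n , w = complete s¬P λ p → none (let n , w = complete sP p in n , inj₁ w) in none (n , inj₂ w)
  decide-at : ∃ (λ n → does (either? n) ≡ true) → Dec P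
  decide-at (n , found) = from-either (either? n) found
    where
    from-either : (d : Dec (Witness sP n ⊎ Witness s¬P n)) → does d ≡ true → Dec P
    from-either (yes (inj₁ w)) _ = yes (sound sP w)
    from-either (yes (inj₂ w)) _ = no (sound s¬P w)

Dec⇒DecidableSet : ∀ {P : Str → Set} → (∀ σ → Dec (P σ)) → DecidableSet P
Dec⇒DecidableSet P? = (λ σ → does (P? σ)) , λ σ → from-does (P? σ) , dec-true (P? σ)
  where
  from-does : ∀ {A : Set} (a? : Dec A) → does a? ≡ true → A
  from-does (yes a) _ = a

Stilde-semidecidable : (f : ℕ → Path) → (∀ i → Paths S (f i)) → DenseIn f S →
  ∀ σ → Semidecidable (Stilde S σ)
Stilde-semidecidable f fS dense σ = record
  { Witness = λ i → σ ≺ f i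
  ; witness? = λ i → σ ≺? f i
  ; sound = λ {i} σ≺fi → f i , fS i , σ≺fi
  ; complete = dense σ
  }

-- Every path of a compact cone that leaves [S] does so at an explicit node (Markov's
-- principle); finitely many such nodes cover the cone.
exits-cover : MarkovPrinciple → Compact (Cone T σ) → ¬ Stilde S σ →
  ∃ λ L → All (λ τ → S τ ≡ false) L × ∀ g → Cone T σ g → Any (_≺ g) L
exits-cover {T} {σ} {S} mp cσ ¬σ∈S̃ = cσ (λ τ → S τ ≡ false) exit
  where
  exit : ∀ g → Cone T σ g → ∃ λ τ → S τ ≡ false × τ ≺ g
  exit g (_ , σ≺g) with n , e ← markov-exit mp (λ n → S (g ↾ n)) (λ gS → ¬σ∈S̃ (g , gS , σ≺g)) =
    g ↾ n , e , ↾-≺ g n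

-- An extension in S longer than every exit extends to a path of T through σ, which
-- passes through one of the exits; that exit is then a prefix of the extension.
¬BoundedExtension-beyond-exits : IsTree T → NoLeaves T → IsSubtree S T → ∀ b L →
  All (λ τ → S τ ≡ false) L → (∀ g → Cone T σ g → Any (_≺ g) L) →
  ¬ BoundedExtension S b (max 0 (map length L)) σ
¬BoundedExtension-beyond-exits {T} {S} {σ} tree noLeaves (S-tree , S⊆T) b L exits covers ext =
  let τ , |τ|≡N , στ∈S = BoundedExtension⇒∈ S b _ ext
      g , gT , στ≺g = extend-to-path {T} tree noLeaves (S⊆T _ στ∈S)
      exits-below-N = zip (exits , All.map⁻ (xs≤max 0 (map length L)))
      (υ∉S , |υ|≤N) , υ≺g = lookupAny exits-below-N (covers g (gT , ⪯-≺ (τ , refl) στ≺g))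
      |υ|≤|στ| = ≤-trans |υ|≤N (subst (_≤ length (σ ++ τ)) |τ|≡N (length-++-≤ʳ τ {σ}))
      υ∈S = ∈-⪯ S-tree (≺-⪯ υ≺g στ≺g |υ|≤|στ|) στ∈S
  in case trans (sym υ∉S) υ∈S of λ ()

¬Stilde-semidecidable : MarkovPrinciple → ComputablyLocallyCompact T → IsSubtree S T →
  Compact (Cone T σ) → Semidecidable (¬ Stilde S σ)
¬Stilde-semidecidable {T} {S} {σ} mp clc sub cσ = record
  { Witness = λ n → ¬ BoundedExtension S (H σ) n σ
  ; witness? = λ n → ¬? (boundedExtension? S (H σ) n σ)
  ; sound = λ { {n} ¬ext (g , gS , σ≺g) →
      ¬ext (path⇒BoundedExtension S (H σ) gS (H-bound-path clc {σ} cσ (S⊆T gS , σ≺g)) n σ≺g) }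
  ; complete = λ ¬σ∈S̃ → let L , exits , covers = exits-cover {T} {σ} {S} mp cσ ¬σ∈S̃ in
      _ , ¬BoundedExtension-beyond-exits {T} {S} {σ} tree noLeaves sub (H σ) L exits covers
  }
  where
  open ComputablyLocallyCompact clc
  S⊆T : Paths S g → Paths T g
  S⊆T gS n = proj₂ sub _ (gS n)

proposition6p8 : MarkovPrinciple →
    (T S : CSet) → ComputablyLocallyCompact T → OnlyRootInfinitelyBranching T →
    IsSubtree S T → (f : ℕ → Path) → (∀ i → Paths S (f i)) → DenseIn f S →
    DecidableSet (Stilde S)
proposition6p8 mp T S clc branching sub f fS dense =
  Dec⇒DecidableSet λ σ → markov-decide mp (Stilde-semidecidable {S} f fS dense σ) (co-semidecidable σ)
  where
  co-semidecidable : ∀ σ → Semidecidable (¬ Stilde S σ)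
  co-semidecidable [] = refuted-semidecidable λ ¬root → ¬root (f 0 , fS 0 , refl)
  co-semidecidable σ@(_ ∷ _) =
    ¬Stilde-semidecidable {T} {S} {σ} mp clc sub (Cone-compact-nonroot clc branching {σ} λ ())
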